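{- Let $k\ge2$. For every integer $j\ge0$, the number $F\!\left(\frac{k^{2j+1}-1}{k-1},\,k\right)$ is divisible by $2(k+1)$.
   Context: Fix an integer $k\ge 2$. Let $T_k$ be the infinite rooted $k$-ary tree (every vertex has exactly $k$ children) with one additional self-loop at the root, so every vertex has degree $k+1$. Chip-firing: a vertex with at least $k+1$ chips may fire, sending one chip along each incident edge (a non-root vertex sends one chip to its parent and one to each of its $k$ children; the root sends one chip to each of its $k$ children and one chip to itself along the self-loop). Starting with $N$ chips at the root and none elsewhere, vertices fire until no vertex can fire; this terminates, and the number of times each vertex fires does not depend on the order of firings. $F(N,k)$ denotes the total number of fires summed over all vertices. -}

module Defs where

open import Data.Nat using (ℕ; zero; suc; _+_; _*_; _∸_; _^_; _≤_; _<_; NonZero; >-nonZero)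
open import Data.Nat.DivMod using (_/_)
open import Data.Nat.Properties using (m<n⇒0<n∸m)
open import Data.Fin as Fin using (Fin)
open import Data.List using (List; []; _∷_; length)
open import Data.List.Properties using (≡-dec)
open import Data.Product using (Σ; _×_; _,_)
open import Relation.Nullary using (Dec; yes; no)
open import Relation.Binary.PropositionalEquality using (_≡_)

-- Vertices of the infinite rooted k-ary tree T_k: a vertex is the path from
-- the root, stored with the LAST step at the head.  The root is [];
-- the children of v are (i ∷ v) for i : Fin k; the parent of (i ∷ p) is p.
Vertex : ℕ → Set
Vertex k = List (Fin k)

_≟V_ : ∀ {k} → (v w : Vertex k) → Dec (v ≡ w)
_≟V_ = ≡-dec Fin._≟_

Config : ℕ → Set
Config k = Vertex k → ℕ

-- number of edges of T_k (including the root self-loop) from v to w,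
-- i.e. the number of chips w receives when v fires.
edges : ∀ {k} → Vertex k → Vertex k → ℕ
edges {k} v w = selfLoop v w + toChild v w + toParent v w
  where
  selfLoop : Vertex k → Vertex k → ℕ
  selfLoop [] [] = 1
  selfLoop _  _  = 0
  toChild : Vertex k → Vertex k → ℕ
  toChild v [] = 0
  toChild v (i ∷ p) with p ≟V v
  ... | yes _ = 1
  ... | no  _ = 0
  toParent : Vertex k → Vertex k → ℕ
  toParent [] w = 0
  toParent (i ∷ p) w with p ≟V w
  ... | yes _ = 1
  ... | no  _ = 0

fire : ∀ {k} → Vertex k → Config k → Config k
fire {k} v c w with w ≟V v
... | yes _ = (c w ∸ suc k) + edges v w
... | no  _ = c w + edges v w

data Legal {k : ℕ} : Config k → List (Vertex k) → Config k → Set where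
  done : ∀ {c} → Legal c [] c
  step : ∀ {c v vs c'} → suc k ≤ c v → Legal (fire v c) vs c' → Legal c (v ∷ vs) c'

Stable : ∀ {k} → Config k → Set
Stable {k} c = ∀ v → c v < suc k

initial : ∀ {k} → ℕ → Config k
initial N [] = N
initial N (_ ∷ _) = 0

Stabilizes : (k N : ℕ) → List (Vertex k) → Set
Stabilizes k N vs = Σ (Config k) λ c' → Legal (initial {k} N) vs c' × Stable c'

startN : (k : ℕ) → 2 ≤ k → ℕ → ℕ
startN k 2≤k j = _/_ (k ^ (2 * j + 1) ∸ 1) (k ∸ 1) {{ >-nonZero (m<n⇒0<n∸m 2≤k) }}

{-# OPTIONS --safe #-}
-- Firing all vertices of one depth keeps a configuration radial (a function of the depth).
-- A wave at depth m fires depths m, m - 1, …, 0 in turn: on top of one chip on each vertex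
-- of depth < m, it turns k extra chips on each vertex of depth m into one extra chip on each
-- vertex of depth m + 1. Writing R n = 1 + k + ⋯ + k^(n-1), start with R (D + 1) = 1 + k R D
-- chips at the root and run R D waves at depth 0, then R (D - 1) waves at depth 1, and so on:
-- this leaves one chip on every vertex of depth ≤ D, a stable configuration. Counting the
-- firings gives S D, where S (n + 1) = k S n + R 1 + ⋯ + R (n + 1); two steps of this
-- recurrence add a multiple of 2(k + 1), so 2(k + 1) divides S (2j). By the least action
-- principle every complete firing sequence has the same length.
module Submission where

open import Defs
open import Algebra.Properties.CommutativeSemigroup as CS using ()
open import Data.Bool.Base using (if_then_else_)
open import Level using (Level)
open import Data.Fin.Base as Fin using (Fin)
open import Data.Fin.Properties using () renaming (_≟_ to _≟ᶠ_)
open import Data.List.Base using (List; []; _∷_; [_]; _++_; map; concat; concatMap; replicate; allFin; length)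
open import Data.List.Properties
  using (++-assoc; ++-identityʳ; length-++; length-map; length-tabulate; map-tabulate; ∷-injectiveˡ; ∷-injectiveʳ)
open import Data.List.Membership.Propositional using (_∈_)
open import Data.List.Membership.Propositional.Properties using (∈-∃++)
open import Data.List.Relation.Unary.Any using (here; there)
open import Data.Nat.Base
open import Data.Nat.Divisibility using (_∣_; divides; _∣0; ∣m∣n⇒∣m+n; m∣m*n; ∣n⇒∣m*n)
open import Data.Nat.DivMod using (_/_; m*n/n≡m)
open import Data.Nat.Properties
open import Data.Nat.Tactic.RingSolver using (solve-∀; solve)
open import Data.Product.Base using (Σ; ∃-syntax; _×_; _,_)
open import Function.Base using (_∘_; id)
open import Relation.Binary.Definitions using (DecidableEquality)
open import Relation.Binary.PropositionalEquality hiding ([_])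
open import Relation.Nullary using (Dec; yes; no; does; ¬_; contradiction)

open CS +-commutativeSemigroup using (interchange; xy∙z≈xz∙y; x∙yz≈xz∙y; x∙yz≈y∙xz)

private variable
  ℓ : Level
  A B P Q : Set ℓ

-- Indicators and finite sums

𝟙 : Dec P → ℕ
𝟙 p? = if does p? then 1 else 0

𝟙-yes : P → (p? : Dec P) → 𝟙 p? ≡ 1
𝟙-yes p (yes _) = refl
𝟙-yes p (no ¬p) = contradiction p ¬p

𝟙-no : ¬ P → (p? : Dec P) → 𝟙 p? ≡ 0
𝟙-no ¬p (yes p) = contradiction p ¬p
𝟙-no ¬p (no _)  = refl

𝟙≤1 : (p? : Dec P) → 𝟙 p? ≤ 1
𝟙≤1 (yes _) = ≤-refl
𝟙≤1 (no _)  = z≤n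

𝟙-⇔ : (P → Q) → (Q → P) → (p? : Dec P) (q? : Dec Q) → 𝟙 p? ≡ 𝟙 q?
𝟙-⇔ f g (yes p) q? = sym (𝟙-yes (f p) q?)
𝟙-⇔ f g (no ¬p) q? = sym (𝟙-no (¬p ∘ g) q?)

*-𝟙-≤ : ∀ {m n} (p? : Dec P) → (P → m ≤ n) → m * 𝟙 p? ≤ n
*-𝟙-≤ {m = m} {n} (yes p) m≤n = subst (_≤ n) (sym (*-identityʳ m)) (m≤n p)
*-𝟙-≤ {m = m} {n} (no _)  _   = subst (_≤ n) (sym (*-zeroʳ m)) z≤n

𝟙-<-suc : ∀ l n → 𝟙 (l <? suc n) ≡ 𝟙 (l <? n) + 𝟙 (l ≟ n)
𝟙-<-suc zero    zero    = refl
𝟙-<-suc zero    (suc n) = refl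
𝟙-<-suc (suc l) zero    = refl
𝟙-<-suc (suc l) (suc n) = 𝟙-<-suc l n

𝟙-pred : ∀ l n → 𝟙 (l ∸ 1 ≟ suc n) ≡ 𝟙 (l ≟ suc (suc n))
𝟙-pred zero    n = refl
𝟙-pred (suc l) n = refl

∑ : List A → (A → ℕ) → ℕ
∑ []       f = 0
∑ (x ∷ xs) f = f x + ∑ xs f

syntax ∑ xs (λ x → e) = ∑[ x ∈ xs ] e

∑-cong : ∀ (xs : List A) {f g : A → ℕ} → (∀ x → f x ≡ g x) → ∑ xs f ≡ ∑ xs g
∑-cong []       f≗g = refl
∑-cong (x ∷ xs) f≗g = cong₂ _+_ (f≗g x) (∑-cong xs f≗g)

∑-const : ∀ (xs : List A) c → ∑[ _ ∈ xs ] c ≡ length xs * c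
∑-const []       c = refl
∑-const (x ∷ xs) c = cong (c +_) (∑-const xs c)

∑-zero : ∀ (xs : List A) → ∑[ _ ∈ xs ] 0 ≡ 0
∑-zero xs = trans (∑-const xs 0) (*-zeroʳ (length xs))

length≡∑1 : ∀ (xs : List A) → length xs ≡ ∑[ _ ∈ xs ] 1
length≡∑1 xs = sym (trans (∑-const xs 1) (*-identityʳ (length xs)))

∑-++ : ∀ xs ys (f : A → ℕ) → ∑ (xs ++ ys) f ≡ ∑ xs f + ∑ ys f
∑-++ []       ys f = refl
∑-++ (x ∷ xs) ys f = trans (cong (f x +_) (∑-++ xs ys f)) (sym (+-assoc (f x) _ _))

∑-++-∷ : ∀ xs x ys (f : A → ℕ) → ∑ (xs ++ x ∷ ys) f ≡ f x + ∑ (xs ++ ys) f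
∑-++-∷ xs x ys f = begin
  ∑ (xs ++ x ∷ ys) f        ≡⟨ ∑-++ xs (x ∷ ys) f ⟩
  ∑ xs f + (f x + ∑ ys f)   ≡⟨ x∙yz≈y∙xz (∑ xs f) (f x) (∑ ys f) ⟩
  f x + (∑ xs f + ∑ ys f)   ≡⟨ cong (f x +_) (∑-++ xs ys f) ⟨
  f x + ∑ (xs ++ ys) f      ∎
  where open ≡-Reasoning

∑-+ : ∀ xs (f g : A → ℕ) → ∑[ x ∈ xs ] (f x + g x) ≡ ∑ xs f + ∑ xs g
∑-+ []       f g = refl
∑-+ (x ∷ xs) f g = begin
  f x + g x + ∑[ x ∈ xs ] (f x + g x)  ≡⟨ cong (f x + g x +_) (∑-+ xs f g) ⟩
  f x + g x + (∑ xs f + ∑ xs g)        ≡⟨ interchange (f x) (g x) _ _ ⟩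
  f x + ∑ xs f + (g x + ∑ xs g)        ∎
  where open ≡-Reasoning

∑-map : ∀ (g : B → A) xs (f : A → ℕ) → ∑ (map g xs) f ≡ ∑[ x ∈ xs ] f (g x)
∑-map g []       f = refl
∑-map g (x ∷ xs) f = cong (f (g x) +_) (∑-map g xs f)

∑-concatMap : ∀ (g : B → List A) xs (f : A → ℕ) →
              ∑ (concatMap g xs) f ≡ ∑[ x ∈ xs ] ∑ (g x) f
∑-concatMap g []       f = refl
∑-concatMap g (x ∷ xs) f = trans (∑-++ (g x) _ f) (cong (∑ (g x) f +_) (∑-concatMap g xs f))

∑-swap : ∀ xs (ys : List B) (f : A → B → ℕ) →
         ∑[ x ∈ xs ] ∑[ y ∈ ys ] f x y ≡ ∑[ y ∈ ys ] ∑[ x ∈ xs ] f x y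
∑-swap []       ys f = sym (∑-zero ys)
∑-swap (x ∷ xs) ys f = begin
  ∑ ys (f x) + ∑[ x ∈ xs ] ∑ ys (f x)    ≡⟨ cong (∑ ys (f x) +_) (∑-swap xs ys f) ⟩
  ∑ ys (f x) + ∑[ y ∈ ys ] ∑[ x ∈ xs ] f x y  ≡⟨ ∑-+ ys (f x) _ ⟨
  ∑[ y ∈ ys ] (f x y + ∑[ x ∈ xs ] f x y)  ∎
  where open ≡-Reasoning

∑-allFin-suc : ∀ n (f : Fin (suc n) → ℕ) → ∑ (allFin (suc n)) f ≡ f Fin.zero + ∑[ i ∈ allFin n ] f (Fin.suc i)
∑-allFin-suc n f =
  cong (f Fin.zero +_) (trans (cong (λ is → ∑ is f) (sym (map-tabulate id Fin.suc))) (∑-map Fin.suc (allFin n) f))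

∑-allFin-𝟙 : ∀ {n} (i : Fin n) → ∑[ j ∈ allFin n ] 𝟙 (i ≟ᶠ j) ≡ 1
∑-allFin-𝟙 {suc n} i = trans (∑-allFin-suc n (λ j → 𝟙 (i ≟ᶠ j))) (split i)
  where
  split : ∀ i → 𝟙 (i ≟ᶠ Fin.zero) + ∑[ j ∈ allFin n ] 𝟙 (i ≟ᶠ Fin.suc j) ≡ 1
  split Fin.zero    = cong suc (∑-zero (allFin n))
  split (Fin.suc i) = ∑-allFin-𝟙 i

module Multiplicity {a} {A : Set a} (_≟_ : DecidableEquality A) where

  count : A → List A → ℕ
  count x xs = ∑[ y ∈ xs ] 𝟙 (x ≟ y)

  𝟙-≟-sym : ∀ x y → 𝟙 (x ≟ y) ≡ 𝟙 (y ≟ x)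
  𝟙-≟-sym x y = 𝟙-⇔ sym sym (x ≟ y) (y ≟ x)

  count-self : ∀ x xs → count x (x ∷ xs) ≡ 1 + count x xs
  count-self x xs = cong (_+ count x xs) (𝟙-yes refl (x ≟ x))

  count>0⇒∈ : ∀ {x} ys → 0 < count x ys → x ∈ ys
  count>0⇒∈ {x} (y ∷ ys) pos with x ≟ y
  ... | yes refl = here refl
  ... | no _     = there (count>0⇒∈ ys pos)

  infix 4 _≼_
  _≼_ : List A → List A → Set a
  xs ≼ ys = ∀ x → count x xs ≤ count x ys

  ∑-mono-≼ : ∀ (f : A → ℕ) xs ys → xs ≼ ys → ∑ xs f ≤ ∑ ys f
  ∑-mono-≼ f []       _  _     = z≤n
  ∑-mono-≼ f (x ∷ xs) ys xs≼ys with ∈-∃++ (count>0⇒∈ ys x-occurs)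
    where
    x-occurs : 0 < count x ys
    x-occurs = ≤-trans (subst (1 ≤_) (sym (count-self x xs)) (s≤s z≤n)) (xs≼ys x)
  ... | us , vs , refl = begin
    f x + ∑ xs f            ≤⟨ +-monoʳ-≤ (f x) (∑-mono-≼ f xs (us ++ vs) xs≼us++vs) ⟩
    f x + ∑ (us ++ vs) f    ≡⟨ ∑-++-∷ us x vs f ⟨
    ∑ (us ++ x ∷ vs) f      ∎
    where
    open ≤-Reasoning
    xs≼us++vs : xs ≼ us ++ vs
    xs≼us++vs z = +-cancelˡ-≤ (𝟙 (z ≟ x)) _ _
      (≤-trans (xs≼ys z) (≤-reflexive (∑-++-∷ us x vs (λ y → 𝟙 (z ≟ y)))))

  ≼⇒length≤ : ∀ xs ys → xs ≼ ys → length xs ≤ length ys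
  ≼⇒length≤ xs ys xs≼ys =
    subst₂ _≤_ (sym (length≡∑1 xs)) (sym (length≡∑1 ys)) (∑-mono-≼ (λ _ → 1) xs ys xs≼ys)

-- Repunits in base k

module _ (k : ℕ) where

  repunit : ℕ → ℕ
  repunit zero    = 0
  repunit (suc n) = repunit n + k ^ n

  repunit-suc : ∀ n → repunit (suc n) ≡ 1 + k * repunit n
  repunit-suc zero    = cong suc (sym (*-zeroʳ k))
  repunit-suc (suc n) = begin
    repunit (suc n) + k * k ^ n          ≡⟨ cong (_+ k * k ^ n) (repunit-suc n) ⟩
    1 + (k * repunit n + k * k ^ n)      ≡⟨ cong suc (*-distribˡ-+ k (repunit n) (k ^ n)) ⟨
    1 + k * repunit (suc n)              ∎
    where open ≡-Reasoning

  repunit-closed : 1 ≤ k → ∀ n → repunit n * (k ∸ 1) + 1 ≡ k ^ n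
  repunit-closed 1≤k zero    = refl
  repunit-closed 1≤k (suc n) = begin
    (repunit n + k ^ n) * (k ∸ 1) + 1         ≡⟨ cong (_+ 1) (*-distribʳ-+ (k ∸ 1) (repunit n) (k ^ n)) ⟩
    repunit n * (k ∸ 1) + k ^ n * (k ∸ 1) + 1 ≡⟨ xy∙z≈xz∙y (repunit n * (k ∸ 1)) _ 1 ⟩
    repunit n * (k ∸ 1) + 1 + k ^ n * (k ∸ 1) ≡⟨ cong (_+ k ^ n * (k ∸ 1)) (repunit-closed 1≤k n) ⟩
    k ^ n + k ^ n * (k ∸ 1)                   ≡⟨ *-suc (k ^ n) (k ∸ 1) ⟨
    k ^ n * suc (k ∸ 1)                       ≡⟨ cong (k ^ n *_) (m+[n∸m]≡n 1≤k) ⟩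
    k ^ n * k                                 ≡⟨ *-comm (k ^ n) k ⟩
    k ^ suc n                                 ∎
    where open ≡-Reasoning

  repunitSum : ℕ → ℕ
  repunitSum zero    = 0
  repunitSum (suc n) = repunitSum n + repunit (suc n)

  -- Each child's subtree fires like the whole tree one level shallower, and the root fires
  -- repunitSum (suc n) times.
  totalFires : ℕ → ℕ
  totalFires zero    = 0
  totalFires (suc n) = k * totalFires n + repunitSum (suc n)

  repunitSum-odd-step : ∀ n → suc k * repunitSum (3 + n) + repunit (4 + n)
                            ≡ suc k * repunitSum (1 + n) + repunit (2 + n) + 2 * suc k * repunit (3 + n)
  repunitSum-odd-step n = regroup k (repunitSum (1 + n)) (repunit (2 + n)) (k ^ (2 + n))
    where
    regroup : ∀ k t r p → suc k * (t + r + (r + p)) + (r + p + k * p) ≡ suc k * t + r + 2 * suc k * (r + p)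
    regroup = solve-∀

  totalFires-step : ∀ n → totalFires (2 + n) ≡ k * k * totalFires n + (suc k * repunitSum (1 + n) + repunit (2 + n))
  totalFires-step n = regroup k (totalFires n) (repunitSum (1 + n)) (repunit (2 + n))
    where
    regroup : ∀ k s t r → k * (k * s + t) + (t + r) ≡ k * k * s + (suc k * t + r)
    regroup = solve-∀

  ∣-repunitSum-odd : ∀ j → 2 * suc k ∣ suc k * repunitSum (1 + 2 * j) + repunit (2 + 2 * j)
  ∣-repunitSum-odd zero    = divides 1 (base k)
    where
    base : ∀ k → suc k * 1 + (1 + k * 1) ≡ 1 * (2 * suc k)
    base = solve-∀
  ∣-repunitSum-odd (suc j) =
    subst (λ n → 2 * suc k ∣ suc k * repunitSum (1 + n) + repunit (2 + n)) (sym (*-suc 2 j))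
      (subst (2 * suc k ∣_) (sym (repunitSum-odd-step (2 * j)))
        (∣m∣n⇒∣m+n (∣-repunitSum-odd j) (m∣m*n (repunit (3 + 2 * j)))))

  ∣-totalFires-even : ∀ j → 2 * suc k ∣ totalFires (2 * j)
  ∣-totalFires-even zero    = (2 * suc k) ∣0
  ∣-totalFires-even (suc j) =
    subst (λ n → 2 * suc k ∣ totalFires n) (sym (*-suc 2 j))
      (subst (2 * suc k ∣_) (sym (totalFires-step (2 * j)))
        (∣m∣n⇒∣m+n (∣n⇒∣m*n (k * k) (∣-totalFires-even j)) (∣-repunitSum-odd j)))

-- Chip-firing on T_k

module _ (k : ℕ) where

  open Multiplicity (_≟V_ {k})

  inflow : Vertex k → List (Vertex k) → ℕ
  inflow w vs = ∑[ v ∈ vs ] edges v w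

  fire-balance : ∀ {v} (c : Config k) w → suc k ≤ c v →
                 fire v c w + suc k * 𝟙 (w ≟V v) ≡ c w + edges v w
  fire-balance {v} c w unstable with w ≟V v
  ... | yes refl = begin
    c w ∸ suc k + edges w w + suc k * 1  ≡⟨ cong (c w ∸ suc k + edges w w +_) (*-identityʳ (suc k)) ⟩
    c w ∸ suc k + edges w w + suc k      ≡⟨ xy∙z≈xz∙y (c w ∸ suc k) (edges w w) (suc k) ⟩
    c w ∸ suc k + suc k + edges w w      ≡⟨ cong (_+ edges w w) (m∸n+n≡m unstable) ⟩
    c w + edges w w                      ∎
    where open ≡-Reasoning
  ... | no _ = trans (cong (c w + edges v w +_) (*-zeroʳ (suc k))) (+-identityʳ _)

  Legal-balance : ∀ {c vs c'} → Legal c vs c' → ∀ w → c' w + suc k * count w vs ≡ c w + inflow w vs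
  Legal-balance {c} done w = cong (c w +_) (*-zeroʳ (suc k))
  Legal-balance {c} (step {v = v} {vs = vs} {c' = c'} unstable L) w = begin
    c' w + suc k * (𝟙 (w ≟V v) + count w vs)
      ≡⟨ cong (c' w +_) (*-distribˡ-+ (suc k) (𝟙 (w ≟V v)) (count w vs)) ⟩
    c' w + (suc k * 𝟙 (w ≟V v) + suc k * count w vs)      ≡⟨ x∙yz≈xz∙y (c' w) _ _ ⟩
    c' w + suc k * count w vs + suc k * 𝟙 (w ≟V v)        ≡⟨ cong (_+ suc k * 𝟙 (w ≟V v)) (Legal-balance L w) ⟩
    fire v c w + inflow w vs + suc k * 𝟙 (w ≟V v)         ≡⟨ xy∙z≈xz∙y (fire v c w) _ _ ⟩
    fire v c w + suc k * 𝟙 (w ≟V v) + inflow w vs         ≡⟨ cong (_+ inflow w vs) (fire-balance c w unstable) ⟩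
    c w + edges v w + inflow w vs                         ≡⟨ +-assoc (c w) _ _ ⟩
    c w + inflow w (v ∷ vs)                               ∎
    where open ≡-Reasoning

  Legal-++ : ∀ {c d e : Config k} {vs ws} → Legal c vs d → Legal d ws e → Legal c (vs ++ ws) e
  Legal-++ done             L₂ = L₂
  Legal-++ (step unstable L₁) L₂ = step unstable (Legal-++ L₁ L₂)

  module LeastAction {c d : Config k} {ws} (ws-legal : Legal c ws d) (d-stable : Stable d) where

    -- Had u already fired as often as in ws, it would hold no more chips than in d.
    lagging : ∀ {pre c₁ u} → Legal c pre c₁ → pre ≼ ws → suc k ≤ c₁ u → count u pre < count u ws
    lagging {pre} {c₁} {u} L pre≼ws unstable =
      ≰⇒> λ ws≤pre → <⇒≱ (d-stable u) (≤-trans unstable (c₁≤d ws≤pre))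
      where
      c₁≤d : count u ws ≤ count u pre → c₁ u ≤ d u
      c₁≤d ws≤pre = +-cancelʳ-≤ (suc k * count u pre) (c₁ u) (d u) (begin
        c₁ u + suc k * count u pre  ≡⟨ Legal-balance L u ⟩
        c u + inflow u pre          ≤⟨ +-monoʳ-≤ (c u) (∑-mono-≼ (λ v → edges v u) pre ws pre≼ws) ⟩
        c u + inflow u ws           ≡⟨ Legal-balance ws-legal u ⟨
        d u + suc k * count u ws    ≤⟨ +-monoʳ-≤ (d u) (*-monoʳ-≤ (suc k) ws≤pre) ⟩
        d u + suc k * count u pre   ∎)
        where open ≤-Reasoning

    extend : ∀ {pre c₁ rest e} → Legal c pre c₁ → pre ≼ ws → Legal c₁ rest e → pre ++ rest ≼ ws
    extend {pre} L pre≼ws done = subst (_≼ ws) (sym (++-identityʳ pre)) pre≼ws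
    extend {pre} L pre≼ws (step {v = u} {vs = rest} unstable L′) =
      subst (_≼ ws) (++-assoc pre [ u ] rest) (extend (Legal-++ L (step unstable done)) pre+u≼ws L′)
      where
      pre+u≼ws : pre ++ [ u ] ≼ ws
      pre+u≼ws x rewrite ∑-++ pre [ u ] (λ y → 𝟙 (x ≟V y)) with x ≟V u
      ... | yes refl = subst (_≤ count x ws) (+-comm 1 (count x pre)) (lagging L pre≼ws unstable)
      ... | no _     = subst (_≤ count x ws) (sym (+-identityʳ (count x pre))) (pre≼ws x)

  leastAction : ∀ {c ws d vs e} → Legal c ws d → Stable d → Legal c vs e → vs ≼ ws
  leastAction ws-legal d-stable vs-legal = LeastAction.extend ws-legal d-stable done (λ _ → z≤n) vs-legal

  stabilising-length-unique : ∀ {c ws d vs e} → Legal c ws d → Stable d → Legal c vs e → Stable e →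
                              length vs ≡ length ws
  stabilising-length-unique {ws = ws} {vs = vs} ws-legal d-stable vs-legal e-stable = ≤-antisym
    (≼⇒length≤ vs ws (leastAction ws-legal d-stable vs-legal))
    (≼⇒length≤ ws vs (leastAction vs-legal e-stable ws-legal))

  infix 4 _⟶[_]_
  _⟶[_]_ : Config k → List (Vertex k) → Config k → Set
  c ⟶[ vs ] d = ∃[ c' ] Legal c vs c' × c' ≗ d

  fire-cong : ∀ v {c d : Config k} → c ≗ d → fire v c ≗ fire v d
  fire-cong v c≗d w with w ≟V v
  ... | yes _ = cong (λ n → n ∸ suc k + edges v w) (c≗d w)
  ... | no _  = cong (_+ edges v w) (c≗d w)

  Legal-cong : ∀ {c d c' : Config k} {vs} → c ≗ d → Legal c vs c' → d ⟶[ vs ] c'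
  Legal-cong c≗d done = _ , done , λ w → sym (c≗d w)
  Legal-cong c≗d (step {v = v} unstable L) with Legal-cong (fire-cong v c≗d) L
  ... | d' , L′ , d'≗c' = d' , step (subst (suc k ≤_) (c≗d v) unstable) L′ , d'≗c'

  ⟶-respˡ : ∀ {c c₂ d : Config k} {vs} → c ≗ c₂ → c ⟶[ vs ] d → c₂ ⟶[ vs ] d
  ⟶-respˡ c≗c₂ (c' , L , c'≗d) with Legal-cong c≗c₂ L
  ... | d' , L′ , d'≗c' = d' , L′ , λ w → trans (d'≗c' w) (c'≗d w)

  ⟶-respʳ : ∀ {c d d₂ : Config k} {vs} → d ≗ d₂ → c ⟶[ vs ] d → c ⟶[ vs ] d₂
  ⟶-respʳ d≗d₂ (c' , L , c'≗d) = c' , L , λ w → trans (c'≗d w) (d≗d₂ w)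

  ⟶-trans : ∀ {c d e : Config k} {vs ws} → c ⟶[ vs ] d → d ⟶[ ws ] e → c ⟶[ vs ++ ws ] e
  ⟶-trans (c' , L₁ , c'≗d) d⟶e with ⟶-respˡ (λ w → sym (c'≗d w)) d⟶e
  ... | e' , L₂ , e'≗e = e' , Legal-++ L₁ L₂ , e'≗e

  infixl 6 _⊕_
  _⊕_ : Config k → Config k → Config k
  (c ⊕ e) v = c v + e v

  fire-⊕ : ∀ {v} (c e : Config k) → suc k ≤ c v → fire v (c ⊕ e) ≗ fire v c ⊕ e
  fire-⊕ {v} c e unstable w with w ≟V v
  ... | yes refl = trans (cong (_+ edges w w) (+-∸-comm (e w) unstable)) (xy∙z≈xz∙y (c w ∸ suc k) (e w) _)
  ... | no _     = xy∙z≈xz∙y (c w) (e w) (edges v w)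

  Legal-⊕ : ∀ {c c' : Config k} {vs} → Legal c vs c' → ∀ e → c ⊕ e ⟶[ vs ] c' ⊕ e
  Legal-⊕ done e = _ , done , λ _ → refl
  Legal-⊕ {c} (step {v = v} unstable L) e with ⟶-respˡ (λ w → sym (fire-⊕ c e unstable w)) (Legal-⊕ L e)
  ... | d , L′ , d≗c'⊕e = d , step (≤-trans unstable (m≤m+n (c v) (e v))) L′ , d≗c'⊕e

  ⟶-⊕ : ∀ {c d : Config k} {vs} → c ⟶[ vs ] d → ∀ e → c ⊕ e ⟶[ vs ] d ⊕ e
  ⟶-⊕ (c' , L , c'≗d) e = ⟶-respʳ (λ w → cong (_+ e w) (c'≗d w)) (Legal-⊕ L e)

  -- Layers of T_k

  -- The self-loop makes the root its own neighbour, so the root is taken to be its own parent.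
  parent : Vertex k → Vertex k
  parent []      = []
  parent (_ ∷ p) = p

  children : Vertex k → List (Vertex k)
  children p = map (_∷ p) (allFin k)

  neighbours : Vertex k → List (Vertex k)
  neighbours w = parent w ∷ children w

  ∑-children : ∀ p (f : Vertex k → ℕ) → ∑ (children p) f ≡ ∑[ i ∈ allFin k ] f (i ∷ p)
  ∑-children p = ∑-map (_∷ p) (allFin k)

  ∑-children-0 : ∀ p {f : Vertex k → ℕ} → (∀ i → f (i ∷ p) ≡ 0) → ∑ (children p) f ≡ 0
  ∑-children-0 p {f} f≡0 =
    trans (∑-children p f) (trans (∑-cong (allFin k) f≡0) (∑-zero (allFin k)))

  count-root-children : ∀ p → count [] (children p) ≡ 0
  count-root-children p = ∑-children-0 p (λ _ → refl)

  count-children : ∀ j q p → count (j ∷ q) (children p) ≡ 𝟙 (q ≟V p)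
  count-children j q p with q ≟V p
  ... | yes refl = trans (∑-children q _)
                     (trans (∑-cong (allFin k) (λ i → 𝟙-⇔ ∷-injectiveˡ (cong (_∷ q)) ((j ∷ q) ≟V (i ∷ q)) (j ≟ᶠ i)))
                       (∑-allFin-𝟙 j))
  ... | no q≢p   = ∑-children-0 p (λ i → 𝟙-no (q≢p ∘ ∷-injectiveʳ) ((j ∷ q) ≟V (i ∷ p)))

  edges≡count-neighbours : ∀ x w → edges x w ≡ count x (neighbours w)
  edges≡count-neighbours []      []      = cong suc (sym (count-root-children []))
  edges≡count-neighbours []      (j ∷ q) rewrite count-root-children (j ∷ q) with q ≟V []
  ... | yes refl = refl
  ... | no q≢[]  = cong (_+ 0) (sym (𝟙-no (q≢[] ∘ sym) ([] ≟V q)))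
  edges≡count-neighbours (i ∷ p) []      rewrite count-children i p [] with p ≟V []
  ... | yes _ = refl
  ... | no _  = refl
  edges≡count-neighbours (i ∷ p) (j ∷ q) rewrite count-children i p (j ∷ q) | 𝟙-≟-sym (i ∷ p) q
    with q ≟V (i ∷ p) | p ≟V (j ∷ q)
  ... | yes _ | yes _ = refl
  ... | yes _ | no _  = refl
  ... | no _  | yes _ = refl
  ... | no _  | no _  = refl

  inflow≡∑-neighbours : ∀ w vs → inflow w vs ≡ ∑[ u ∈ neighbours w ] count u vs
  inflow≡∑-neighbours w vs = begin
    ∑[ x ∈ vs ] edges x w                         ≡⟨ ∑-cong vs (λ x → edges≡count-neighbours x w) ⟩
    ∑[ x ∈ vs ] ∑[ u ∈ neighbours w ] 𝟙 (x ≟V u)  ≡⟨ ∑-swap vs (neighbours w) (λ x u → 𝟙 (x ≟V u)) ⟩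
    ∑[ u ∈ neighbours w ] ∑[ x ∈ vs ] 𝟙 (x ≟V u)
      ≡⟨ ∑-cong (neighbours w) (λ u → ∑-cong vs (λ x → 𝟙-≟-sym x u)) ⟩
    ∑[ u ∈ neighbours w ] count u vs              ∎
    where open ≡-Reasoning

  layer : ℕ → List (Vertex k)
  layer zero    = [ [] ]
  layer (suc d) = concatMap children (layer d)

  count-layer : ∀ d w → count w (layer d) ≡ 𝟙 (length w ≟ d)
  count-layer zero    []      = refl
  count-layer zero    (_ ∷ _) = refl
  count-layer (suc d) w = trans (∑-concatMap children (layer d) _) (via-children w)
    where
    via-children : ∀ w → ∑[ p ∈ layer d ] count w (children p) ≡ 𝟙 (length w ≟ suc d)
    via-children []      = trans (∑-cong (layer d) count-root-children) (∑-zero (layer d))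
    via-children (j ∷ q) = trans (∑-cong (layer d) (count-children j q)) (count-layer d q)

  length-parent : ∀ w → length (parent w) ≡ length w ∸ 1
  length-parent []      = refl
  length-parent (_ ∷ _) = refl

  inflow-layer : ∀ d w → inflow w (layer d) ≡ 𝟙 (length w ∸ 1 ≟ d) + k * 𝟙 (suc (length w) ≟ d)
  inflow-layer d w = begin
    inflow w (layer d)                                          ≡⟨ inflow≡∑-neighbours w (layer d) ⟩
    count (parent w) (layer d) + ∑[ u ∈ children w ] count u (layer d)
      ≡⟨ cong₂ _+_ (count-layer d (parent w))
                   (trans (∑-children w _) (∑-cong (allFin k) (λ i → count-layer d (i ∷ w)))) ⟩
    𝟙 (length (parent w) ≟ d) + ∑[ i ∈ allFin k ] 𝟙 (suc (length w) ≟ d)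
      ≡⟨ cong₂ _+_ (cong (λ l → 𝟙 (l ≟ d)) (length-parent w)) (∑-const (allFin k) _) ⟩
    𝟙 (length w ∸ 1 ≟ d) + length (allFin k) * 𝟙 (suc (length w) ≟ d)
      ≡⟨ cong (λ n → 𝟙 (length w ∸ 1 ≟ d) + n * 𝟙 (suc (length w) ≟ d)) (length-tabulate {n = k} id) ⟩
    𝟙 (length w ∸ 1 ≟ d) + k * 𝟙 (suc (length w) ≟ d)           ∎
    where open ≡-Reasoning

  length-children : ∀ p → length (children p) ≡ k
  length-children p = trans (length-map (_∷ p) (allFin k)) (length-tabulate id)

  length-concatMap-children : ∀ ps → length (concatMap children ps) ≡ k * length ps
  length-concatMap-children []       = sym (*-zeroʳ k)
  length-concatMap-children (p ∷ ps) = begin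
    length (children p ++ concatMap children ps)   ≡⟨ length-++ (children p) ⟩
    length (children p) + length (concatMap children ps)
      ≡⟨ cong₂ _+_ (length-children p) (length-concatMap-children ps) ⟩
    k + k * length ps                              ≡⟨ *-suc k (length ps) ⟨
    k * length (p ∷ ps)                            ∎
    where open ≡-Reasoning

  length-layer : ∀ d → length (layer d) ≡ k ^ d
  length-layer zero    = refl
  length-layer (suc d) = trans (length-concatMap-children (layer d)) (cong (k *_) (length-layer d))

  -- Firing a vertex only ever removes chips from that vertex.
  Legal-of-distinct : ∀ {c : Config k} vs → (∀ v → count v vs ≤ 1) → (∀ v → suc k * count v vs ≤ c v) →
                      ∃[ c' ] Legal c vs c'
  Legal-of-distinct []       _     _      = _ , done
  Legal-of-distinct {c} (v ∷ vs) once enough with Legal-of-distinct vs once′ enough′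
    where
    v∉vs : count v vs ≡ 0
    v∉vs = n≤0⇒n≡0 (+-cancelˡ-≤ 1 _ 0 (subst (_≤ 1) (count-self v vs) (once v)))
    once′ : ∀ u → count u vs ≤ 1
    once′ u = ≤-trans (m≤n+m (count u vs) _) (once u)
    enough′ : ∀ u → suc k * count u vs ≤ fire v c u
    enough′ u with u ≟V v
    ... | yes refl = ≤-trans (≤-reflexive (trans (cong (suc k *_) v∉vs) (*-zeroʳ (suc k)))) z≤n
    ... | no _     = begin
      suc k * count u vs          ≤⟨ *-monoʳ-≤ (suc k) (m≤n+m (count u vs) _) ⟩
      suc k * count u (v ∷ vs)    ≤⟨ enough u ⟩
      c u                         ≤⟨ m≤m+n (c u) (edges v u) ⟩
      c u + edges v u             ∎
      where open ≤-Reasoning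
  ... | c' , L = c' , step unstable L
    where
    unstable : suc k ≤ c v
    unstable = ≤-trans (m≤m*n (suc k) (suc (count v vs))) (subst (λ n → suc k * n ≤ c v) (count-self v vs) (enough v))

  radial : (ℕ → ℕ) → Config k
  radial a v = a (length v)

  -- b is a after firing depth d, stated without truncated subtraction; since the root is its
  -- own parent, the parent's depth is l ∸ 1.
  layer-fires : ∀ d (a b : ℕ → ℕ) → suc k ≤ a d →
                (∀ l → b l + suc k * 𝟙 (l ≟ d) ≡ a l + 𝟙 (l ∸ 1 ≟ d) + k * 𝟙 (suc l ≟ d)) →
                radial a ⟶[ layer d ] radial b
  layer-fires d a b unstable balance with Legal-of-distinct (layer d) once enough
    where
    once : ∀ v → count v (layer d) ≤ 1
    once v = subst (_≤ 1) (sym (count-layer d v)) (𝟙≤1 (length v ≟ d))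
    enough : ∀ v → suc k * count v (layer d) ≤ radial a v
    enough v = subst (λ n → suc k * n ≤ a (length v)) (sym (count-layer d v))
                 (*-𝟙-≤ (length v ≟ d) (λ l≡d → subst (λ l → suc k ≤ a l) (sym l≡d) unstable))
  ... | c' , L = c' , L , λ w → +-cancelʳ-≡ (suc k * 𝟙 (length w ≟ d)) (c' w) (b (length w)) (begin
    c' w + suc k * 𝟙 (length w ≟ d)          ≡⟨ cong (λ n → c' w + suc k * n) (count-layer d w) ⟨
    c' w + suc k * count w (layer d)         ≡⟨ Legal-balance L w ⟩
    a (length w) + inflow w (layer d)        ≡⟨ cong (a (length w) +_) (inflow-layer d w) ⟩
    a (length w) + (𝟙 (length w ∸ 1 ≟ d) + k * 𝟙 (suc (length w) ≟ d))   ≡⟨ +-assoc (a (length w)) _ _ ⟨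
    a (length w) + 𝟙 (length w ∸ 1 ≟ d) + k * 𝟙 (suc (length w) ≟ d)     ≡⟨ balance (length w) ⟨
    b (length w) + suc k * 𝟙 (length w ≟ d)  ∎)
    where open ≡-Reasoning

  -- Waves

  unstable-at : ∀ x d → suc k ≤ x + suc k * 𝟙 (d ≟ d)
  unstable-at x d = ≤-trans (≤-reflexive (sym (trans (cong (suc k *_) (𝟙-yes refl (d ≟ d))) (*-identityʳ (suc k)))))
                            (m≤n+m (suc k * 𝟙 (d ≟ d)) x)

  wave : ℕ → List (Vertex k)
  wave zero    = layer zero
  wave (suc m) = layer (suc m) ++ wave m

  -- Firing a depth gives each parent one chip from each of its k children, so the depth above
  -- can fire next.
  wave-moves : ∀ m →
    radial (λ l → 𝟙 (l <? m) + suc k * 𝟙 (l ≟ m)) ⟶[ wave m ] radial (λ l → 𝟙 (l <? 2 + m))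
  wave-moves zero = layer-fires 0 _ (λ l → 𝟙 (l <? 2)) (unstable-at 0 0) balance
    where
    balance : ∀ l → 𝟙 (l <? 2) + suc k * 𝟙 (l ≟ 0)
                  ≡ 𝟙 (l <? 0) + suc k * 𝟙 (l ≟ 0) + 𝟙 (l ∸ 1 ≟ 0) + k * 𝟙 (suc l ≟ 0)
    balance zero          = solve (k ∷ [])
    balance (suc zero)    = solve (k ∷ [])
    balance (suc (suc l)) = solve (k ∷ [])
  wave-moves (suc m) =
    ⟶-trans (layer-fires (suc m) _ after-layer (unstable-at (𝟙 (suc m <? suc m)) (suc m)) balance)
            (⟶-respʳ (λ v → sym (𝟙-<-suc (length v) (2 + m)))
                     (⟶-⊕ (wave-moves m) (radial (λ l → 𝟙 (l ≟ 2 + m)))))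
    where
    after-layer : ℕ → ℕ
    after-layer l = 𝟙 (l <? m) + suc k * 𝟙 (l ≟ m) + 𝟙 (l ≟ 2 + m)
    regroup : ∀ k B E F G → B + suc k * E + G + suc k * F ≡ B + E + suc k * F + G + k * E
    regroup = solve-∀
    balance : ∀ l → after-layer l + suc k * 𝟙 (l ≟ suc m)
                  ≡ 𝟙 (l <? suc m) + suc k * 𝟙 (l ≟ suc m) + 𝟙 (l ∸ 1 ≟ suc m) + k * 𝟙 (suc l ≟ suc m)
    balance l rewrite 𝟙-<-suc l m | 𝟙-pred l m =
      regroup k (𝟙 (l <? m)) (𝟙 (l ≟ m)) (𝟙 (l ≟ suc m)) (𝟙 (l ≟ 2 + m))

  waves-move : ∀ m q y →
    radial (λ l → 𝟙 (l <? suc m) + k * q * 𝟙 (l ≟ m) + y * 𝟙 (l ≟ suc m))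
      ⟶[ concat (replicate q (wave m)) ]
    radial (λ l → 𝟙 (l <? suc m) + (y + q) * 𝟙 (l ≟ suc m))
  waves-move m zero    y =
    _ , done , λ v → no-waves k (𝟙 (length v <? suc m)) (𝟙 (length v ≟ m)) y (𝟙 (length v ≟ suc m))
    where
    no-waves : ∀ k B E y F → B + k * 0 * E + y * F ≡ B + (y + 0) * F
    no-waves = solve-∀
  waves-move m (suc q) y =
    ⟶-trans (⟶-respˡ (λ v → sym (split v)) (⟶-respʳ merge (⟶-⊕ (wave-moves m) rest)))
            (⟶-respʳ (λ v → cong (λ n → 𝟙 (length v <? suc m) + n * 𝟙 (length v ≟ suc m)) (sym (+-suc y q)))
                     (waves-move m q (suc y)))
    where
    rest : Config k
    rest = radial (λ l → k * q * 𝟙 (l ≟ m) + y * 𝟙 (l ≟ suc m))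
    split-eq : ∀ k B E q y F → B + E + k * suc q * E + y * F ≡ B + suc k * E + (k * q * E + y * F)
    split-eq = solve-∀
    split : radial (λ l → 𝟙 (l <? suc m) + k * suc q * 𝟙 (l ≟ m) + y * 𝟙 (l ≟ suc m))
            ≗ radial (λ l → 𝟙 (l <? m) + suc k * 𝟙 (l ≟ m)) ⊕ rest
    split v rewrite 𝟙-<-suc (length v) m =
      split-eq k (𝟙 (length v <? m)) (𝟙 (length v ≟ m)) q y (𝟙 (length v ≟ suc m))
    merge-eq : ∀ k B F q E y → B + F + (k * q * E + y * F) ≡ B + k * q * E + suc y * F
    merge-eq = solve-∀
    merge : radial (λ l → 𝟙 (l <? 2 + m)) ⊕ rest
            ≗ radial (λ l → 𝟙 (l <? suc m) + k * q * 𝟙 (l ≟ m) + suc y * 𝟙 (l ≟ suc m))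
    merge v rewrite 𝟙-<-suc (length v) (suc m) =
      merge-eq k (𝟙 (length v <? suc m)) (𝟙 (length v ≟ suc m)) q (𝟙 (length v ≟ m)) y

  descent : ℕ → ℕ → List (Vertex k)
  descent m zero    = []
  descent m (suc n) = concat (replicate (repunit k (suc n)) (wave m)) ++ descent (suc m) n

  descent-stabilises : ∀ m n →
    radial (λ l → 𝟙 (l <? m) + repunit k (suc n) * 𝟙 (l ≟ m))
      ⟶[ descent m n ]
    radial (λ l → 𝟙 (l <? suc (m + n)))
  descent-stabilises m zero = _ , done , λ v → begin
    𝟙 (length v <? m) + (𝟙 (length v ≟ m) + 0)   ≡⟨ cong (𝟙 (length v <? m) +_) (+-identityʳ _) ⟩
    𝟙 (length v <? m) + 𝟙 (length v ≟ m)         ≡⟨ 𝟙-<-suc (length v) m ⟨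
    𝟙 (length v <? suc m)                         ≡⟨ cong (λ n → 𝟙 (length v <? suc n)) (+-identityʳ m) ⟨
    𝟙 (length v <? suc (m + 0))                   ∎
    where open ≡-Reasoning
  descent-stabilises m (suc n) =
    ⟶-trans (⟶-respˡ (λ v → sym (prepare v)) (waves-move m (repunit k (suc n)) 0))
            (⟶-respʳ (λ v → cong (λ n → 𝟙 (length v <? suc n)) (sym (+-suc m n))) (descent-stabilises (suc m) n))
    where
    prepare-eq : ∀ k B E r F → B + (1 + k * r) * E ≡ B + E + k * r * E + 0 * F
    prepare-eq = solve-∀
    prepare : radial (λ l → 𝟙 (l <? m) + repunit k (suc (suc n)) * 𝟙 (l ≟ m))
              ≗ radial (λ l → 𝟙 (l <? suc m) + k * repunit k (suc n) * 𝟙 (l ≟ m) + 0 * 𝟙 (l ≟ suc m))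
    prepare v rewrite repunit-suc k (suc n) | 𝟙-<-suc (length v) m =
      prepare-eq k (𝟙 (length v <? m)) (𝟙 (length v ≟ m)) (repunit k (suc n)) (𝟙 (length v ≟ suc m))

  length-replicate-concat : ∀ q (xs : List (Vertex k)) → length (concat (replicate q xs)) ≡ q * length xs
  length-replicate-concat zero    xs = refl
  length-replicate-concat (suc q) xs = trans (length-++ xs) (cong (length xs +_) (length-replicate-concat q xs))

  length-wave : ∀ m → length (wave m) ≡ repunit k (suc m)
  length-wave zero    = refl
  length-wave (suc m) = begin
    length (layer (suc m) ++ wave m)          ≡⟨ length-++ (layer (suc m)) ⟩
    length (layer (suc m)) + length (wave m)  ≡⟨ cong₂ _+_ (length-layer (suc m)) (length-wave m) ⟩
    k ^ suc m + repunit k (suc m)             ≡⟨ +-comm (k ^ suc m) _ ⟩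
    repunit k (suc (suc m))                   ∎
    where open ≡-Reasoning

  length-descent : ∀ m n → length (descent m n) ≡ repunit k m * repunitSum k n + k ^ m * totalFires k n
  length-descent m zero    = sym (cong₂ _+_ (*-zeroʳ (repunit k m)) (*-zeroʳ (k ^ m)))
  length-descent m (suc n) = begin
    length (concat (replicate r (wave m)) ++ descent (suc m) n)
      ≡⟨ length-++ (concat (replicate r (wave m))) ⟩
    length (concat (replicate r (wave m))) + length (descent (suc m) n)
      ≡⟨ cong₂ _+_ (trans (length-replicate-concat r (wave m)) (cong (r *_) (length-wave m)))
                   (length-descent (suc m) n) ⟩
    r * (repunit k m + k ^ m) + ((repunit k m + k ^ m) * repunitSum k n + k * k ^ m * totalFires k n)
      ≡⟨ regroup k (repunit k m) (k ^ m) r (repunitSum k n) (totalFires k n) ⟩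
    repunit k m * (repunitSum k n + r) + k ^ m * (k * totalFires k n + (repunitSum k n + r)) ∎
    where
    open ≡-Reasoning
    r = repunit k (suc n)
    regroup : ∀ k ρ p r t s → r * (ρ + p) + ((ρ + p) * t + k * p * s) ≡ ρ * (t + r) + p * (k * s + (t + r))
    regroup = solve-∀

startN≡repunit : ∀ k (2≤k : 2 ≤ k) j → startN k 2≤k j ≡ repunit k (suc (2 * j))
startN≡repunit k 2≤k j = begin
  (k ^ (2 * j + 1) ∸ 1) / (k ∸ 1)          ≡⟨ cong (λ n → (k ^ n ∸ 1) / (k ∸ 1)) (+-comm (2 * j) 1) ⟩
  (k ^ suc (2 * j) ∸ 1) / (k ∸ 1)
    ≡⟨ cong (λ n → (n ∸ 1) / (k ∸ 1)) (repunit-closed k (<⇒≤ 2≤k) (suc (2 * j))) ⟨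
  (r * (k ∸ 1) + 1 ∸ 1) / (k ∸ 1)          ≡⟨ cong (_/ (k ∸ 1)) (m+n∸n≡m (r * (k ∸ 1)) 1) ⟩
  r * (k ∸ 1) / (k ∸ 1)                    ≡⟨ m*n/n≡m r (k ∸ 1) ⟩
  r                                        ∎
  where
  open ≡-Reasoning
  r = repunit k (suc (2 * j))
  instance
    k∸1≢0 : NonZero (k ∸ 1)
    k∸1≢0 = >-nonZero (m<n⇒0<n∸m 2≤k)

mainTheorem14 : (k : ℕ) → (2≤k : 2 ≤ k) → (j : ℕ) →
    Σ (List (Vertex k)) (λ vs → Stabilizes k (startN k 2≤k j) vs)
    × ((vs : List (Vertex k)) → Stabilizes k (startN k 2≤k j) vs →
         (2 * suc k) ∣ length vs)
mainTheorem14 k 2≤k j with ⟶-respˡ k start≗ (descent-stabilises k 0 (2 * j))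
  where
  start≗ : radial k (λ l → repunit k (suc (2 * j)) * 𝟙 (l ≟ 0)) ≗ initial (startN k 2≤k j)
  start≗ []      = trans (*-identityʳ _) (sym (startN≡repunit k 2≤k j))
  start≗ (_ ∷ _) = *-zeroʳ (repunit k (suc (2 * j)))
... | c' , L , c'≗final = (descent k 0 (2 * j) , c' , L , stable) , λ vs (_ , L′ , stable′) →
  subst (2 * suc k ∣_) (sym (fires L′ stable′)) (∣-totalFires-even k j)
  where
  stable : Stable c'
  stable v = subst (_< suc k) (sym (c'≗final v)) (s≤s (≤-trans (𝟙≤1 (length v <? suc (2 * j))) (<⇒≤ 2≤k)))
  fires : ∀ {vs e} → Legal (initial (startN k 2≤k j)) vs e → Stable e → length vs ≡ totalFires k (2 * j)
  fires L′ stable′ = trans (stabilising-length-unique k L stable L′ stable′)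
                           (trans (length-descent k 0 (2 * j)) (+-identityʳ _))
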